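{- Let $m\ge 0$ and $L\ge 1$, put $M=2^{K(m)}L$ and $N=2^M=B(m)^L$. Then \[ \sum_{\substack{0\le n<N\\ a_m(n)=0}} n^k=\sum_{\substack{0\le n<N\\ a_m(n)=1}} n^k\qquad\text{for } k=0,1,\dots,s_mL-1. \]
   Context: For $n\ge0$ write $b_p(n)=\lfloor n/2^p\rfloor\bmod 2$ for its binary digits; $\oplus$ is XOR and $\&$ is bitwise AND. For $m\ge 0$, $a_m(n)=\bigoplus_{p\ge0,\ p\,\&\,m=0} b_p(n)$ (this is the $m$-th iterate of the Thue--Morse transform starting from the Thue--Morse sequence; $a_0$ is the Thue--Morse sequence). Let $K(m)=\max(1,\lceil\log_2(m+1)\rceil)$, $B(m)=2^{2^{K(m)}}$, and $s_m=|\{p\in[0,2^{K(m)}):p\,\&\,m=0\}|=2^{K(m)-\mathrm{popcount}(m)}$, where $\mathrm{popcount}(m)$ is the number of $1$-bits of $m$. -}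

module Defs where

open import Data.Nat using (ℕ; zero; suc; _+_; _*_; _^_; _∸_; _≡ᵇ_)
open import Data.Nat.DivMod using (_/_; _%_)
open import Data.Nat.Properties using (m^n≢0)
open import Data.Nat.Logarithm using (⌈log₂_⌉)
open import Data.Bool using (Bool; true; false; _xor_; _∧_; if_then_else_)
open import Data.List using (List; upTo; filter; map; foldr; length)
open import Data.Bool.Properties using (_≟_)
open import Relation.Nullary.Decidable using (Dec)
open import Data.Bool.Properties using (T?)

bit : ℕ → ℕ → Bool
bit p n = ((_/_ n (2 ^ p) {{m^n≢0 2 p}}) % 2) ≡ᵇ 1

-- p & m = 0  (bitwise AND is zero). Bits q ≥ p + m of p and m vanish
-- (since x < 2^x), so checking q < p + m suffices.
andZero : ℕ → ℕ → Bool
andZero p m = foldr (λ q acc → (if bit q p ∧ bit q m then false else true) ∧ acc) true (upTo (p + m))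

popcount : ℕ → ℕ
popcount m = length (filter (λ q → T? (bit q m)) (upTo m))

-- a_m(n) = XOR of b_p(n) over p ≥ 0 with p & m = 0.
-- Only p < n can contribute (b_p(n) = 0 for p ≥ n since n < 2^n).
a : ℕ → ℕ → Bool
a m n = foldr (λ p acc → (andZero p m ∧ bit p n) xor acc) false (upTo n)

K : ℕ → ℕ
K m with ⌈log₂ (suc m) ⌉
... | zero = 1
... | suc k = suc k

B : ℕ → ℕ
B m = 2 ^ (2 ^ K m)

s : ℕ → ℕ
s m = length (filter (λ p → T? (andZero p m)) (upTo (2 ^ K m)))

powerSum : (m N k : ℕ) → Bool → ℕ
powerSum m N k v = foldr _+_ 0 (map (λ n → n ^ k) (filter (λ n → a m n ≟ v) (upTo N)))

-- Adding the top bit 2^M to n < 2^M flips a_m(n) exactly when M & m = 0, so on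
-- [0, 2^(M+1)) the colouring a_m is its restriction to [0, 2^M) followed either by a
-- copy or by the complement of it. Prouhet's induction shows that any colouring with
-- this doubling law splits [0, 2^M) into two classes on which every polynomial of
-- degree below #{p < M : step p complements} has the same sum: a copying step applies
-- the induction hypothesis to f and to f(2^M + ·), a complementing step writes
-- f(2^M + x) = f(x) + g(x) with deg g < deg f. Since p & m = 0 depends only on
-- p mod 2^K(m), the number of complementing steps below 2^K(m) L is s_m L.
module Submission where

open import Defs
open import Data.Nat using (ℕ; _*_; _^_; _<_; _≤_)
open import Data.Bool using (true; false)
open import Relation.Binary.PropositionalEquality using (_≡_)

open import Algebra.Definitions using (Associative; Identity)
open import Data.Bool using (Bool; T; _xor_; _∧_; if_then_else_)
open import Data.Bool.Properties
  using (_≟_; T?; xor-assoc; xor-comm; xor-identity; ∧-assoc; ∧-identity; ∧-identityʳ; ∧-zeroʳ)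
open import Data.Empty using (⊥-elim)
open import Data.List
  using (List; []; _∷_; _++_; map; filter; filterᵇ; foldr; upTo; applyUpTo; length)
open import Data.List.Membership.Propositional using (_∈_)
open import Data.List.Membership.Propositional.Properties using (∈-upTo⁻)
open import Data.List.Properties
  using (filter-++; filter-accept; filter-reject; length-++; map-++; map-cong; map-upTo; upTo-∷ʳ; foldr-++)
open import Data.List.Relation.Unary.All using (All; []; _∷_; tabulate)
open import Data.Nat using (suc; zero; _+_; _∸_; _≡ᵇ_; >-nonZero; z≤n; s≤s; _≤′_; ≤′-refl; ≤′-step; ⌈_/2⌉)
open import Data.Nat.Divisibility using (divides; ∣-refl)
open import Data.Nat.DivMod using (_/_; _%_; m<n⇒m/n≡0; +-distrib-/-∣ˡ; n/n≡1; m*n/n≡m; %-remove-+ˡ)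
open import Data.Nat.Induction using (<-rec)
open import Data.Nat.ListAction using (sum)
open import Data.Nat.ListAction.Properties using (sum-++)
open import Data.Nat.Logarithm using (⌈log₂_⌉; ⌈log₂⌉-mono-≤; ⌈log₂⌈n/2⌉⌉≡⌈log₂n⌉∸1; ⌈log₂2^n⌉≡n)
open import Data.Nat.Properties hiding (_≟_)
open import Data.Nat.Tactic.RingSolver using (solve-∀)
open import Data.Product using (∃-syntax; _×_; _,_; proj₁; proj₂)
open import Data.Unit using (tt)
open import Relation.Binary.PropositionalEquality
  using (refl; sym; trans; cong; cong₂; subst; subst₂; module ≡-Reasoning)
open import Relation.Nullary using (yes; no)
open import Algebra.Properties.CommutativeSemigroup +-commutativeSemigroup
  using (interchange; x∙yz≈y∙xz)
import Algebra.Properties.CommutativeSemigroup *-commutativeSemigroup as *-CS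

open ≡-Reasoning

-- Polynomials of degree < d, via forward differences. Being ℕ-valued, the differences
-- only capture polynomials with f x ≤ f (c + x), which includes the monomials x ↦ x ^ k.

data DegreeBelow : ℕ → (ℕ → ℕ) → Set where
  vanishing   : ∀ {f} → (∀ x → f x ≡ 0) → DegreeBelow 0 f
  differences : ∀ {d f} → (∀ c → ∃[ g ] DegreeBelow d g × (∀ x → f (c + x) ≡ f x + g x)) →
                DegreeBelow (suc d) f

degree-zero : ∀ d → DegreeBelow d (λ _ → 0)
degree-zero zero    = vanishing (λ _ → refl)
degree-zero (suc d) = differences λ c → (λ _ → 0) , degree-zero d , λ _ → refl

degree-mono : ∀ {d e f} → d ≤ e → DegreeBelow d f → DegreeBelow e f
degree-mono {e = zero}  z≤n f≡0 = f≡0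
degree-mono {e = suc e} z≤n (vanishing f≡0) = differences λ c →
  (λ _ → 0) , degree-zero e , λ x → trans (f≡0 (c + x)) (sym (cong (_+ 0) (f≡0 x)))
degree-mono (s≤s d≤e) (differences Δ) = differences λ c →
  let g , deg-g , f≡f+g = Δ c in g , degree-mono d≤e deg-g , f≡f+g

degree-+ : ∀ {d f g} → DegreeBelow d f → DegreeBelow d g → DegreeBelow d (λ x → f x + g x)
degree-+ (vanishing f≡0) (vanishing g≡0) = vanishing λ x → cong₂ _+_ (f≡0 x) (g≡0 x)
degree-+ {f = f} {g} (differences Δf) (differences Δg) = differences λ c →
  let f′ , deg-f′ , ef = Δf c ; g′ , deg-g′ , eg = Δg c
  in (λ x → f′ x + g′ x) , degree-+ deg-f′ deg-g′ ,
     λ x → trans (cong₂ _+_ (ef x) (eg x)) (interchange (f x) (f′ x) (g x) (g′ x))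

degree-scale : ∀ {d f} k → DegreeBelow d f → DegreeBelow d (λ x → k * f x)
degree-scale k (vanishing f≡0) = vanishing λ x → trans (cong (k *_) (f≡0 x)) (*-zeroʳ k)
degree-scale {f = f} k (differences Δ) = differences λ c →
  let g , deg-g , e = Δ c
  in (λ x → k * g x) , degree-scale k deg-g ,
     λ x → trans (cong (k *_) (e x)) (*-distribˡ-+ k (f x) (g x))

degree-shift : ∀ {d f} b → DegreeBelow d f → DegreeBelow d (λ x → f (b + x))
degree-shift b (vanishing f≡0) = vanishing λ x → f≡0 (b + x)
degree-shift {f = f} b (differences Δ) = differences λ c →
  let g , deg-g , e = Δ c
  in (λ x → g (b + x)) , degree-shift b deg-g ,
     λ x → trans (cong f (x∙yz≈y∙xz b c x)) (e (b + x))

degree-x* : ∀ {d h} → DegreeBelow d h → DegreeBelow (suc d) (λ x → x * h x)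
degree-x* (vanishing h≡0) = degree-mono z≤n (vanishing λ x → trans (cong (x *_) (h≡0 x)) (*-zeroʳ x))
degree-x* {suc d} {h} deg-h@(differences Δ) = differences λ c →
  let g , deg-g , e = Δ c
  in (λ x → c * h x + (x * g x + c * g x)) ,
     degree-+ (degree-scale c deg-h)
              (degree-+ (degree-x* deg-g) (degree-mono (n≤1+n d) (degree-scale c deg-g))) ,
     λ x → trans (cong ((c + x) *_) (e x)) (expand c x (h x) (g x))
  where
  expand : ∀ c x a b → (c + x) * (a + b) ≡ x * a + (c * a + (x * b + c * b))
  expand = solve-∀

degree-^ : ∀ k → DegreeBelow (suc k) (λ x → x ^ k)
degree-^ zero    = differences λ c → (λ _ → 0) , degree-zero 0 , λ _ → refl
degree-^ (suc k) = degree-x* (degree-^ k)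

-- Sums and counts over colour classes

sumWhere : (ℕ → Bool) → Bool → (ℕ → ℕ) → List ℕ → ℕ
sumWhere σ v f xs = sum (map f (filter (λ n → σ n ≟ v) xs))

module _ (σ : ℕ → Bool) (v : Bool) where

  sumWhere-++ : ∀ f xs ys → sumWhere σ v f (xs ++ ys) ≡ sumWhere σ v f xs + sumWhere σ v f ys
  sumWhere-++ f xs ys = begin
    sum (map f (filter P? (xs ++ ys)))
      ≡⟨ cong (λ zs → sum (map f zs)) (filter-++ P? xs ys) ⟩
    sum (map f (filter P? xs ++ filter P? ys))
      ≡⟨ cong sum (map-++ f (filter P? xs) (filter P? ys)) ⟩
    sum (map f (filter P? xs) ++ map f (filter P? ys))
      ≡⟨ sum-++ (map f (filter P? xs)) _ ⟩
    sumWhere σ v f xs + sumWhere σ v f ys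
      ∎
    where P? = λ n → σ n ≟ v

  sumWhere-cong : ∀ {f g} → (∀ x → f x ≡ g x) → ∀ xs → sumWhere σ v f xs ≡ sumWhere σ v g xs
  sumWhere-cong f≗g xs = cong sum (map-cong f≗g (filter (λ n → σ n ≟ v) xs))

  sumWhere-+ : ∀ f g xs → sumWhere σ v (λ x → f x + g x) xs ≡ sumWhere σ v f xs + sumWhere σ v g xs
  sumWhere-+ f g [] = refl
  sumWhere-+ f g (x ∷ xs) with σ x ≟ v
  ... | yes _ = trans (cong (f x + g x +_) (sumWhere-+ f g xs)) (interchange (f x) (g x) _ _)
  ... | no  _ = sumWhere-+ f g xs

  sumWhere-zero : ∀ {f} → (∀ x → f x ≡ 0) → ∀ xs → sumWhere σ v f xs ≡ 0
  sumWhere-zero f≡0 [] = refl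
  sumWhere-zero f≡0 (x ∷ xs) with σ x ≟ v
  ... | yes _ = cong₂ _+_ (f≡0 x) (sumWhere-zero f≡0 xs)
  ... | no  _ = sumWhere-zero f≡0 xs

xor-transpose : ∀ b {s v} → b xor s ≡ v → s ≡ b xor v
xor-transpose false         refl = refl
xor-transpose true {false}  refl = refl
xor-transpose true {true}   refl = refl

sumWhere-map-+ : ∀ σ v f d b xs → All (λ x → σ (d + x) ≡ b xor σ x) xs →
  sumWhere σ v f (map (d +_) xs) ≡ sumWhere σ (b xor v) (λ x → f (d + x)) xs
sumWhere-map-+ σ v f d b [] [] = refl
sumWhere-map-+ σ v f d b (x ∷ xs) (σ-shift ∷ σ-shifts)
  with σ (d + x) ≟ v | σ x ≟ b xor v
... | yes _ | yes _ = cong (f (d + x) +_) (sumWhere-map-+ σ v f d b xs σ-shifts)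
... | no  _ | no  _ = sumWhere-map-+ σ v f d b xs σ-shifts
... | yes p | no ¬q = ⊥-elim (¬q (xor-transpose b (trans (sym σ-shift) p)))
... | no ¬p | yes q = ⊥-elim (¬p (trans σ-shift (sym (xor-transpose b (sym q)))))

countBelow : (ℕ → Bool) → ℕ → ℕ
countBelow t R = length (filterᵇ t (upTo R))

applyUpTo-+ : ∀ (f : ℕ → ℕ) a b → applyUpTo f (a + b) ≡ applyUpTo f a ++ applyUpTo (λ i → f (a + i)) b
applyUpTo-+ f zero    b = refl
applyUpTo-+ f (suc a) b = cong (f 0 ∷_) (applyUpTo-+ (λ i → f (suc i)) a b)

upTo-+ : ∀ a b → upTo (a + b) ≡ upTo a ++ map (a +_) (upTo b)
upTo-+ a b = trans (applyUpTo-+ (λ i → i) a b) (cong (upTo a ++_) (sym (map-upTo (a +_) b)))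

length-filterᵇ-map : ∀ {A B : Set} (t : B → Bool) (t′ : A → Bool) (g : A → B) →
  (∀ x → t (g x) ≡ t′ x) → ∀ xs → length (filterᵇ t (map g xs)) ≡ length (filterᵇ t′ xs)
length-filterᵇ-map t t′ g e [] = refl
length-filterᵇ-map t t′ g e (x ∷ xs) rewrite e x with t′ x
... | true  = cong suc (length-filterᵇ-map t t′ g e xs)
... | false = length-filterᵇ-map t t′ g e xs

countBelow-+ : ∀ {t d} → (∀ x → t (d + x) ≡ t x) → ∀ e →
  countBelow t (d + e) ≡ countBelow t d + countBelow t e
countBelow-+ {t} {d} periodic e = begin
  length (filterᵇ t (upTo (d + e)))
    ≡⟨ cong (λ (xs : List ℕ) → length (filterᵇ t xs)) (upTo-+ d e) ⟩
  length (filterᵇ t (upTo d ++ map (d +_) (upTo e)))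
    ≡⟨ cong length (filter-++ (λ x → T? (t x)) (upTo d) (map (d +_) (upTo e))) ⟩
  length (filterᵇ t (upTo d) ++ filterᵇ t (map (d +_) (upTo e)))
    ≡⟨ length-++ (filterᵇ t (upTo d)) ⟩
  countBelow t d + length (filterᵇ t (map (d +_) (upTo e)))
    ≡⟨ cong (countBelow t d +_) (length-filterᵇ-map t t (d +_) periodic (upTo e)) ⟩
  countBelow t d + countBelow t e
    ∎

countBelow-periodic : ∀ {t d} → (∀ x → t (d + x) ≡ t x) → ∀ L →
  countBelow t (d * L) ≡ countBelow t d * L
countBelow-periodic {t} {d} periodic zero =
  trans (cong (countBelow t) (*-zeroʳ d)) (sym (*-zeroʳ (countBelow t d)))
countBelow-periodic {t} {d} periodic (suc L) = begin
  countBelow t (d * suc L)                       ≡⟨ cong (countBelow t) (*-suc d L) ⟩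
  countBelow t (d + d * L)                       ≡⟨ countBelow-+ periodic (d * L) ⟩
  countBelow t d + countBelow t (d * L)          ≡⟨ cong (countBelow t d +_) (countBelow-periodic periodic L) ⟩
  countBelow t d + countBelow t d * L            ≡⟨ *-suc (countBelow t d) L ⟨
  countBelow t d * suc L                         ∎

countBelow-suc : ∀ t R → countBelow t (suc R) ≡ countBelow t R + length (filterᵇ t (R ∷ []))
countBelow-suc t R = begin
  length (filterᵇ t (upTo (suc R)))                  ≡⟨ cong (λ (xs : List ℕ) → length (filterᵇ t xs)) (upTo-∷ʳ R) ⟨
  length (filterᵇ t (upTo R ++ R ∷ []))              ≡⟨ cong length (filter-++ (λ x → T? (t x)) (upTo R) (R ∷ [])) ⟩
  length (filterᵇ t (upTo R) ++ filterᵇ t (R ∷ []))  ≡⟨ length-++ (filterᵇ t (upTo R)) ⟩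
  countBelow t R + length (filterᵇ t (R ∷ []))       ∎

countBelow-suc-true : ∀ t R → t R ≡ true → countBelow t (suc R) ≡ suc (countBelow t R)
countBelow-suc-true t R tR = trans (countBelow-suc t R)
  (trans (cong (λ (xs : List ℕ) → countBelow t R + length xs)
               (filter-accept (λ p → T? (t p)) (subst T (sym tR) tt)))
         (+-comm _ 1))

countBelow-suc-false : ∀ t R → t R ≡ false → countBelow t (suc R) ≡ countBelow t R
countBelow-suc-false t R tR = trans (countBelow-suc t R)
  (trans (cong (λ (xs : List ℕ) → countBelow t R + length xs)
               (filter-reject (λ p → T? (t p)) (subst T tR)))
         (+-identityʳ _))

module _ (σ t : ℕ → Bool) (σ-doubling : ∀ M n → n < 2 ^ M → σ (2 ^ M + n) ≡ t M xor σ n) where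

  sumWhere-halves : ∀ M {b} → t M ≡ b → ∀ v f →
    sumWhere σ v f (upTo (2 ^ suc M))
      ≡ sumWhere σ v f (upTo (2 ^ M)) + sumWhere σ (b xor v) (λ x → f (2 ^ M + x)) (upTo (2 ^ M))
  sumWhere-halves M {b} tM≡b v f = begin
    sumWhere σ v f (upTo (2 ^ suc M))
      ≡⟨ cong (λ n → sumWhere σ v f (upTo (D + n))) (+-identityʳ D) ⟩
    sumWhere σ v f (upTo (D + D))
      ≡⟨ cong (sumWhere σ v f) (upTo-+ D D) ⟩
    sumWhere σ v f (upTo D ++ map (D +_) (upTo D))
      ≡⟨ sumWhere-++ σ v f (upTo D) _ ⟩
    sumWhere σ v f (upTo D) + sumWhere σ v f (map (D +_) (upTo D))
      ≡⟨ cong (sumWhere σ v f (upTo D) +_) (sumWhere-map-+ σ v f D b (upTo D) (tabulate doubling)) ⟩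
    sumWhere σ v f (upTo D) + sumWhere σ (b xor v) (λ x → f (D + x)) (upTo D)
      ∎
    where
    D = 2 ^ M
    doubling : ∀ {x} → x ∈ upTo D → σ (D + x) ≡ b xor σ x
    doubling x∈ = trans (σ-doubling M _ (∈-upTo⁻ x∈)) (cong (_xor σ _) tM≡b)

  prouhet : ∀ M {f} → DegreeBelow (countBelow t M) f →
    sumWhere σ false f (upTo (2 ^ M)) ≡ sumWhere σ true f (upTo (2 ^ M))
  prouhet zero (vanishing f≡0) =
    trans (sumWhere-zero σ false f≡0 (0 ∷ [])) (sym (sumWhere-zero σ true f≡0 (0 ∷ [])))
  prouhet (suc M) {f} deg with t M in tM
  ... | false = begin
    S false f (upTo (2 ^ suc M))      ≡⟨ sumWhere-halves M tM false f ⟩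
    S false f U + S false f↑ U        ≡⟨ cong₂ _+_ (prouhet M deg′) (prouhet M (degree-shift D deg′)) ⟩
    S true f U + S true f↑ U          ≡⟨ sumWhere-halves M tM true f ⟨
    S true f (upTo (2 ^ suc M))       ∎
    where
    S = sumWhere σ
    D = 2 ^ M
    U = upTo D
    f↑ = λ x → f (D + x)
    deg′ : DegreeBelow (countBelow t M) f
    deg′ = subst (λ d → DegreeBelow d f) (countBelow-suc-false t M tM) deg
  ... | true with differences Δ ← subst (λ d → DegreeBelow d f) (countBelow-suc-true t M tM) deg
             with g , deg-g , f↑≡f+g ← Δ (2 ^ M) = begin
    S false f (upTo (2 ^ suc M))              ≡⟨ sumWhere-halves M tM false f ⟩
    S false f U + S true f↑ U                 ≡⟨ cong (S false f U +_) (split true) ⟩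
    S false f U + (S true f U + S true g U)   ≡⟨ cong (λ z → S false f U + (S true f U + z)) (prouhet M deg-g) ⟨
    S false f U + (S true f U + S false g U)  ≡⟨ x∙yz≈y∙xz (S false f U) (S true f U) (S false g U) ⟩
    S true f U + (S false f U + S false g U)  ≡⟨ cong (S true f U +_) (split false) ⟨
    S true f U + S false f↑ U                 ≡⟨ sumWhere-halves M tM true f ⟨
    S true f (upTo (2 ^ suc M))               ∎
    where
    S = sumWhere σ
    D = 2 ^ M
    U = upTo D
    f↑ = λ x → f (D + x)
    split : ∀ v → S v f↑ U ≡ S v f U + S v g U
    split v = trans (sumWhere-cong σ v f↑≡f+g U) (sumWhere-+ σ v f g U)

-- Binary digits

n<2^n : ∀ n → n < 2 ^ n
n<2^n zero    = s≤s z≤n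
n<2^n (suc n) = ≤-trans (s≤s (n<2^n n))
  (subst (_≤ 2 ^ suc n) (+-comm (2 ^ n) 1) (+-monoʳ-≤ (2 ^ n) (≤-trans (m^n>0 2 n) (m≤m+n (2 ^ n) 0))))

bit-≥ : ∀ {p n R} → n < 2 ^ R → R ≤ p → bit p n ≡ false
bit-≥ {p} n<2^R R≤p = cong (λ q → q % 2 ≡ᵇ 1) (m<n⇒m/n≡0 (<-≤-trans n<2^R (^-monoʳ-≤ 2 R≤p)))
  where instance _ = m^n≢0 2 p

bit-top : ∀ Q {n} → n < 2 ^ Q → bit Q (2 ^ Q + n) ≡ true
bit-top Q {n} n<2^Q = cong (λ q → q % 2 ≡ᵇ 1)
  (trans (+-distrib-/-∣ˡ n (∣-refl {2 ^ Q})) (cong₂ _+_ (n/n≡1 (2 ^ Q)) (m<n⇒m/n≡0 n<2^Q)))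
  where instance _ = m^n≢0 2 Q

bit-+-even : ∀ q k n → bit q (2 ^ q * (2 * k) + n) ≡ bit q n
bit-+-even q k n = cong (_≡ᵇ 1) (begin
  (2 ^ q * (2 * k) + n) / 2 ^ q % 2
    ≡⟨ cong (_% 2) (+-distrib-/-∣ˡ n (divides (2 * k) (*-comm (2 ^ q) _))) ⟩
  (2 ^ q * (2 * k) / 2 ^ q + n / 2 ^ q) % 2
    ≡⟨ cong (λ z → (z / 2 ^ q + n / 2 ^ q) % 2) (*-comm (2 ^ q) (2 * k)) ⟩
  (2 * k * 2 ^ q / 2 ^ q + n / 2 ^ q) % 2
    ≡⟨ cong (λ z → (z + n / 2 ^ q) % 2) (m*n/n≡m (2 * k) (2 ^ q)) ⟩
  (2 * k + n / 2 ^ q) % 2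
    ≡⟨ %-remove-+ˡ (n / 2 ^ q) (divides k (*-comm 2 k)) ⟩
  n / 2 ^ q % 2
    ∎)
  where instance _ = m^n≢0 2 q

bit-low : ∀ {q Q} n → q < Q → bit q (2 ^ Q + n) ≡ bit q n
bit-low {q} n q<Q with r , refl ← m≤n⇒∃[o]m+o≡n q<Q =
  trans (cong (λ z → bit q (z + n)) 2^Q≡) (bit-+-even q (2 ^ r) n)
  where
  2^Q≡ : 2 ^ (suc q + r) ≡ 2 ^ q * (2 * 2 ^ r)
  2^Q≡ = trans (cong (2 *_) (^-distribˡ-+-* 2 q r)) (*-CS.x∙yz≈y∙xz 2 (2 ^ q) (2 ^ r))

module UpToFold {A : Set} (_∙_ : A → A → A) (ε : A)
                (∙-assoc : Associative _≡_ _∙_) (∙-identity : Identity _≡_ ε _∙_) where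

  private
    ∙-identityˡ = proj₁ ∙-identity
    ∙-identityʳ = proj₂ ∙-identity
  private
    step : (ℕ → A) → ℕ → A → A
    step h p acc = h p ∙ acc

  foldUpTo : (ℕ → A) → ℕ → A
  foldUpTo h R = foldr (step h) ε (upTo R)

  foldr-init : ∀ h xs e → foldr (step h) e xs ≡ foldr (step h) ε xs ∙ e
  foldr-init h []       e = sym (∙-identityˡ e)
  foldr-init h (x ∷ xs) e = trans (cong (h x ∙_) (foldr-init h xs e)) (sym (∙-assoc (h x) _ e))

  foldUpTo-suc : ∀ h R → foldUpTo h (suc R) ≡ foldUpTo h R ∙ h R
  foldUpTo-suc h R = begin
    foldr (step h) ε (upTo (suc R))       ≡⟨ cong (foldr (step h) ε) (upTo-∷ʳ R) ⟨
    foldr (step h) ε (upTo R ++ R ∷ [])   ≡⟨ foldr-++ (step h) ε (upTo R) (R ∷ []) ⟩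
    foldr (step h) (h R ∙ ε) (upTo R)     ≡⟨ foldr-init h (upTo R) (h R ∙ ε) ⟩
    foldUpTo h R ∙ (h R ∙ ε)              ≡⟨ cong (foldUpTo h R ∙_) (∙-identityʳ (h R)) ⟩
    foldUpTo h R ∙ h R                    ∎

  foldUpTo-cong : ∀ {h h′} R → (∀ p → p < R → h p ≡ h′ p) → foldUpTo h R ≡ foldUpTo h′ R
  foldUpTo-cong zero    h≡h′ = refl
  foldUpTo-cong {h} {h′} (suc R) h≡h′ = begin
    foldUpTo h (suc R)   ≡⟨ foldUpTo-suc h R ⟩
    foldUpTo h R ∙ h R   ≡⟨ cong₂ _∙_ (foldUpTo-cong R λ p p<R → h≡h′ p (m<n⇒m<1+n p<R))
                                      (h≡h′ R ≤-refl) ⟩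
    foldUpTo h′ R ∙ h′ R ≡⟨ foldUpTo-suc h′ R ⟨
    foldUpTo h′ (suc R)  ∎

  foldUpTo-stable : ∀ {h R R′} → (∀ p → R ≤ p → h p ≡ ε) → R ≤′ R′ → foldUpTo h R′ ≡ foldUpTo h R
  foldUpTo-stable vanish ≤′-refl = refl
  foldUpTo-stable {h} {R} vanish (≤′-step {R′} R≤′R′) = begin
    foldUpTo h (suc R′)  ≡⟨ foldUpTo-suc h R′ ⟩
    foldUpTo h R′ ∙ h R′ ≡⟨ cong₂ _∙_ (foldUpTo-stable vanish R≤′R′) (vanish R′ (≤′⇒≤ R≤′R′)) ⟩
    foldUpTo h R ∙ ε     ≡⟨ ∙-identityʳ _ ⟩
    foldUpTo h R         ∎

  foldUpTo-support : ∀ {h} R R′ → (∀ p → R ≤ p → h p ≡ ε) → (∀ p → R′ ≤ p → h p ≡ ε) →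
    foldUpTo h R ≡ foldUpTo h R′
  foldUpTo-support R R′ vanish vanish′ =
    trans (sym (foldUpTo-stable vanish (≤⇒≤′ (m≤m+n R R′))))
          (foldUpTo-stable vanish′ (≤⇒≤′ (m≤n+m R′ R)))

module Xor = UpToFold _xor_ false xor-assoc xor-identity
module And = UpToFold _∧_ true ∧-assoc ∧-identity

-- By definition a m n = Xor.foldUpTo (summand m n) n and
-- andZero p m = And.foldUpTo (disjointAt p m) (p + m).
summand : ℕ → ℕ → ℕ → Bool
summand m n p = andZero p m ∧ bit p n

a-digits : ∀ m n R → n < 2 ^ R → a m n ≡ Xor.foldUpTo (summand m n) R
a-digits m n R n<2^R = Xor.foldUpTo-support n R (vanish (n<2^n n)) (vanish n<2^R)
  where
  vanish : ∀ {R} → n < 2 ^ R → ∀ p → R ≤ p → summand m n p ≡ false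
  vanish n<2^R p R≤p = trans (cong (andZero p m ∧_) (bit-≥ n<2^R R≤p)) (∧-zeroʳ _)

a-doubling : ∀ m M n → n < 2 ^ M → a m (2 ^ M + n) ≡ andZero M m xor a m n
a-doubling m M n n<2^M = begin
  a m (2 ^ M + n)
    ≡⟨ a-digits m _ (suc M) 2^M+n<2^[1+M] ⟩
  Xor.foldUpTo (summand m (2 ^ M + n)) (suc M)
    ≡⟨ Xor.foldUpTo-suc (summand m (2 ^ M + n)) M ⟩
  Xor.foldUpTo (summand m (2 ^ M + n)) M xor summand m (2 ^ M + n) M
    ≡⟨ cong₂ _xor_ (Xor.foldUpTo-cong M λ p p<M → cong (andZero p m ∧_) (bit-low n p<M)) top-summand ⟩
  Xor.foldUpTo (summand m n) M xor andZero M m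
    ≡⟨ cong (_xor andZero M m) (a-digits m n M n<2^M) ⟨
  a m n xor andZero M m
    ≡⟨ xor-comm (a m n) _ ⟩
  andZero M m xor a m n
    ∎
  where
  2^M+n<2^[1+M] : 2 ^ M + n < 2 ^ suc M
  2^M+n<2^[1+M] =
    subst (2 ^ M + n <_) (cong (2 ^ M +_) (sym (+-identityʳ (2 ^ M)))) (+-monoʳ-< (2 ^ M) n<2^M)
  top-summand : summand m (2 ^ M + n) M ≡ andZero M m
  top-summand = trans (cong (andZero M m ∧_) (bit-top M n<2^M)) (∧-identityʳ _)

disjointAt : ℕ → ℕ → ℕ → Bool
disjointAt p m q = if bit q p ∧ bit q m then false else true

andZero-digits : ∀ p m R → m < 2 ^ R → andZero p m ≡ And.foldUpTo (disjointAt p m) R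
andZero-digits p m R m<2^R =
  And.foldUpTo-support (p + m) R (vanish (<-≤-trans (n<2^n m) (^-monoʳ-≤ 2 (m≤n+m m p)))) (vanish m<2^R)
  where
  vanish : ∀ {R} → m < 2 ^ R → ∀ q → R ≤ q → disjointAt p m q ≡ true
  vanish m<2^R q R≤q =
    cong (λ b → if b then false else true) (trans (cong (bit q p ∧_) (bit-≥ m<2^R R≤q)) (∧-zeroʳ _))

andZero-periodic : ∀ {m R} → m < 2 ^ R → ∀ p → andZero (2 ^ R + p) m ≡ andZero p m
andZero-periodic {m} {R} m<2^R p = begin
  andZero (2 ^ R + p) m
    ≡⟨ andZero-digits _ m R m<2^R ⟩
  And.foldUpTo (disjointAt (2 ^ R + p) m) R
    ≡⟨ And.foldUpTo-cong R (λ q q<R → cong (λ b → if b ∧ bit q m then false else true) (bit-low p q<R)) ⟩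
  And.foldUpTo (disjointAt p m) R
    ≡⟨ andZero-digits p m R m<2^R ⟨
  andZero p m
    ∎

n≤2*⌈n/2⌉ : ∀ n → n ≤ 2 * ⌈ n /2⌉
n≤2*⌈n/2⌉ n = subst₂ _≤_ (⌊n/2⌋+⌈n/2⌉≡n n) (cong (⌈ n /2⌉ +_) (sym (+-identityʳ ⌈ n /2⌉)))
  (+-monoˡ-≤ ⌈ n /2⌉ (⌊n/2⌋≤⌈n/2⌉ n))

n≤2^⌈log₂n⌉ : ∀ n → n ≤ 2 ^ ⌈log₂ n ⌉
n≤2^⌈log₂n⌉ = <-rec _ bound
  where
  bound : ∀ n → (∀ {m} → m < n → m ≤ 2 ^ ⌈log₂ m ⌉) → n ≤ 2 ^ ⌈log₂ n ⌉
  bound zero             _  = z≤n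
  bound (suc zero)       _  = m^n>0 2 ⌈log₂ 1 ⌉
  bound n@(suc (suc k)) ih =
    ≤-trans (n≤2*⌈n/2⌉ n) (≤-trans (*-monoʳ-≤ 2 (ih (⌈n/2⌉<n k))) (≤-reflexive double))
    where
    log≥1 : 1 ≤ ⌈log₂ n ⌉
    log≥1 = subst (_≤ ⌈log₂ n ⌉) (⌈log₂2^n⌉≡n 1) (⌈log₂⌉-mono-≤ {2} {n} (s≤s (s≤s z≤n)))
    double : 2 * 2 ^ ⌈log₂ ⌈ n /2⌉ ⌉ ≡ 2 ^ ⌈log₂ n ⌉
    double = begin
      2 * 2 ^ ⌈log₂ ⌈ n /2⌉ ⌉   ≡⟨ cong (λ e → 2 * 2 ^ e) (⌈log₂⌈n/2⌉⌉≡⌈log₂n⌉∸1 n) ⟩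
      2 ^ suc (⌈log₂ n ⌉ ∸ 1)   ≡⟨ cong (2 ^_) (suc-pred ⌈log₂ n ⌉ {{>-nonZero log≥1}}) ⟩
      2 ^ ⌈log₂ n ⌉             ∎

K-≥ : ∀ m → ⌈log₂ (suc m) ⌉ ≤ K m
K-≥ m with ⌈log₂ (suc m) ⌉
... | zero  = z≤n
... | suc _ = ≤-refl

m<2^K : ∀ m → m < 2 ^ K m
m<2^K m = ≤-trans (n≤2^⌈log₂n⌉ (suc m)) (^-monoʳ-≤ 2 (K-≥ m))

-- By definition powerSum m N k v = sumWhere (a m) v (λ n → n ^ k) (upTo N) and
-- s m = countBelow (λ p → andZero p m) (2 ^ K m). The hypothesis 1 ≤ L is unused: for L = 0 no k qualifies.
theorem15 : (m L : ℕ) → 1 ≤ L → (k : ℕ) → k < s m * L →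
    powerSum m (2 ^ (2 ^ K m * L)) k false ≡ powerSum m (2 ^ (2 ^ K m * L)) k true
theorem15 m L _ k k<s·L =
  prouhet (a m) (λ p → andZero p m) (a-doubling m) (2 ^ K m * L) (degree-mono k<count (degree-^ k))
  where
  k<count : k < countBelow (λ p → andZero p m) (2 ^ K m * L)
  k<count = subst (k <_)
    (sym (countBelow-periodic {d = 2 ^ K m} (andZero-periodic {R = K m} (m<2^K m)) L)) k<s·L
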